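{- Let $\boldsymbol{Z}=\{z_{i,j}\in\mathbb{F}^2: i,j\in\mathbb{N}\}$ be a node set, let $m,n\in\mathbb{N}$ and $b,c\in\mathbb{F}$. For $i,j\in\mathbb{N}$ let $\boldsymbol{L}^i\boldsymbol{D}^j\boldsymbol{Z}=\{w_{a,b'}=z_{a+i,b'+j}: a,b'\in\mathbb{N}\}$. Then $$\tilde g_{m,n}((x+b,y+c);\boldsymbol{Z})=\sum_{i=0}^m\sum_{j=0}^n\binom{m}{i}\binom{n}{j}\,\tilde g_{m-i,n-j}((b,c);\boldsymbol{L}^i\boldsymbol{D}^j\boldsymbol{Z})\,x^{(i)}y^{(j)},$$ where $\tilde g_{m-i,n-j}((b,c);\cdot)$ denotes evaluation at $(x,y)=(b,c)$.
   Context: $\mathbb{F}$ is a field of characteristic zero. For $p\in\mathbb{F}[x,y]$, $\Delta_x p(x,y)=p(x,y)-p(x-1,y)$ and $\Delta_y p(x,y)=p(x,y)-p(x,y-1)$. For $z\in\mathbb{F}^2$, $\varepsilon(z)$ denotes evaluation at $(x,y)=z$. Write $(i,j)\preceq(m,n)$ if $i\le m$ and $j\le n$. $\Pi^2_{m,n}$ is the space of polynomials of degree at most $m$ in $x$ and at most $n$ in $y$. For a node set $\boldsymbol{W}=\{w_{i,j}\}$ and $m,n\in\mathbb{N}$, $\tilde g_{m,n}((x,y);\boldsymbol{W})$ is the unique polynomial in $\Pi^2_{m,n}$ with $\varepsilon(w_{i,j})\Delta_x^i\Delta_y^j\tilde g_{m,n}((x,y);\boldsymbol{W})=m!\,n!\,\delta_{m,i}\delta_{n,j}$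 for all $(i,j)\preceq(m,n)$. The upper factorial is $t^{(0)}=1$, $t^{(k)}=t(t+1)\cdots(t+k-1)$. -}

module Defs where

open import Level using (Level; _⊔_)
open import Data.Nat as ℕ using (ℕ; zero; suc; _∸_)
open import Data.Nat.Combinatorics using (_C_)
open import Data.Fin as Fin using (Fin; toℕ)
open import Data.Product using (_×_; _,_; ∃)
open import Data.Bool using (Bool; true; false; _∧_)
open import Relation.Nullary using (¬_; does)
open import Relation.Binary.PropositionalEquality using (_≡_)
open import Algebra.Bundles using (CommutativeRing)

module _ {c ℓ : Level} (R : CommutativeRing c ℓ) where
  open CommutativeRing R

  natF : ℕ → Carrier
  natF zero    = 0#
  natF (suc k) = 1# + natF k

  record IsField : Set (c ⊔ ℓ) where
    field
      1≉0 : ¬ (1# ≈ 0#)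
      inverse : ∀ x → ¬ (x ≈ 0#) → ∃ λ y → x * y ≈ 1#

  CharZero : Set ℓ
  CharZero = ∀ k → natF k ≈ 0# → k ≡ 0

  pow : Carrier → ℕ → Carrier
  pow x zero    = 1#
  pow x (suc k) = pow x k * x

  rising : Carrier → ℕ → Carrier
  rising t zero    = 1#
  rising t (suc k) = rising t k * (t + natF k)

  sumTo : ℕ → (ℕ → Carrier) → Carrier
  sumTo zero    f = f 0
  sumTo (suc m) f = sumTo m f + f (suc m)

  sumFin : ∀ {k} → (Fin k → Carrier) → Carrier
  sumFin {zero}  f = 0#
  sumFin {suc k} f = f Fin.zero + sumFin (λ i → f (Fin.suc i))

  Point : Set c
  Point = Carrier × Carrier

  NodeSet : Set c
  NodeSet = ℕ → ℕ → Point

  shiftNodes : ℕ → ℕ → NodeSet → NodeSet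
  shiftNodes i j Z a b = Z (a ℕ.+ i) (b ℕ.+ j)

  Poly : ℕ → ℕ → Set c
  Poly m n = Fin (suc m) → Fin (suc n) → Carrier

  eval : ∀ {m n} → Poly m n → Point → Carrier
  eval p (x , y) =
    sumFin (λ k → sumFin (λ l → p k l * (pow x (toℕ k) * pow y (toℕ l))))

  Δx : (Point → Carrier) → Point → Carrier
  Δx f (x , y) = f (x , y) - f (x - 1# , y)

  Δy : (Point → Carrier) → Point → Carrier
  Δy f (x , y) = f (x , y) - f (x , y - 1#)

  iter : ℕ → ((Point → Carrier) → Point → Carrier) → (Point → Carrier) → Point → Carrier
  iter zero    D f = f
  iter (suc k) D f = D (iter k D f)

  target : ℕ → ℕ → ℕ → ℕ → Carrier
  target m n i j with does (i ℕ.≟ m) ∧ does (j ℕ.≟ n)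
  ... | true  = natF ((m ℕ.!) ℕ.* (n ℕ.!))
  ... | false = 0#

  IsGTilde : (m n : ℕ) → NodeSet → Poly m n → Set ℓ
  IsGTilde m n W p =
    ∀ i j → i ℕ.≤ m → j ℕ.≤ n →
      iter i Δx (iter j Δy (eval p)) (W i j) ≈ target m n i j

-- Since Δ t^(k) = k t^(k-1), rising factorials are to backward differences what monomials are
-- to derivatives: every f of degree ≤ m in x and ≤ n in y obeys Newton's formula
--   f (x + b , y + c) = Σ_{i,j} (Δx^i Δy^j f)(b , c) / (i! j!) · x^(i) y^(j),
-- because both sides have the same differences Δx^a Δy^b at (b , c), and such a function is
-- determined by the values Δx^a Δy^b f (w_{a,b}), a ≤ m, b ≤ n, at any nodes. This uniqueness
-- reduces to one variable, where a polynomial with vanishing Δ agrees with a constant on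
-- w, w - 1, w - 2, ..., infinitely many distinct points in characteristic zero. Comparing
-- interpolation data on L^i D^j Z, uniqueness also gives
--   (m-i)! (n-j)! Δx^i Δy^j g̃_{m,n}(·; Z) = m! n! g̃_{m-i,n-j}(·; L^i D^j Z),
-- and cancelling the nonzero factorials turns the Newton coefficients into the binomial ones.

module Submission where

open import Defs
open import Level using (Level; _⊔_)
open import Data.Nat as ℕ using (ℕ; zero; suc; _∸_; z≤n; s≤s; _!)
import Data.Nat.Properties as ℕP
open import Data.Nat.Combinatorics using (_C_; nCk≡n!/k![n-k]!; k![n∸k]!∣n!)
open import Data.Nat.DivMod using (m/n*n≡m)
open import Data.Integer as ℤ using (ℤ; +_; -[1+_]; _⊖_)
import Data.Integer.Properties as ℤP
import Data.Sign as Sign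
open import Data.Fin as Fin using (Fin; toℕ)
import Data.Fin.Properties as FinP
open import Data.Bool.Properties using (∧-zeroʳ)
open import Data.Maybe using (Maybe; just; nothing)
open import Data.Empty using (⊥-elim)
open import Data.Product using (_×_; _,_; proj₁; proj₂; ∃)
open import Relation.Nullary using (¬_; yes; no; does)
open import Relation.Nullary.Decidable using (dec-true; dec-false)
open import Relation.Binary.PropositionalEquality as ≡ using (_≡_; _≢_; ≢-sym)
open import Algebra.Bundles using (CommutativeRing)
open import Algebra.Solver.Ring.AlmostCommutativeRing
  using (fromCommutativeRing; _-Raw-AlmostCommutative⟶_)

module NatCast {c ℓ : Level} (R : CommutativeRing c ℓ) where
  open CommutativeRing R hiding (zero)
  open import Relation.Binary.Reasoning.Setoid setoid

  natF-+ : ∀ m n → natF R (m ℕ.+ n) ≈ natF R m + natF R n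
  natF-+ zero    n = sym (+-identityˡ _)
  natF-+ (suc m) n = trans (+-congˡ (natF-+ m n)) (sym (+-assoc _ _ _))

  natF-* : ∀ m n → natF R (m ℕ.* n) ≈ natF R m * natF R n
  natF-* zero    n = sym (zeroˡ _)
  natF-* (suc m) n = begin
    natF R (n ℕ.+ m ℕ.* n)             ≈⟨ natF-+ n (m ℕ.* n) ⟩
    natF R n + natF R (m ℕ.* n)        ≈⟨ +-cong (sym (*-identityˡ _)) (natF-* m n) ⟩
    1# * natF R n + natF R m * natF R n ≈⟨ distribʳ _ _ _ ⟨
    (1# + natF R m) * natF R n          ∎

-- The ring solver needs coefficients with decidable equality, which R lacks:
-- they are taken in ℤ and mapped into R by ι.
module RingSolver {c ℓ : Level} (R : CommutativeRing c ℓ) where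
  open CommutativeRing R hiding (zero)
  open import Algebra.Properties.Ring ring
  open import Relation.Binary.Reasoning.Setoid setoid
  open NatCast R

  ι : ℤ → Carrier
  ι (+ n)    = natF R n
  ι -[1+ n ] = - natF R (suc n)

  private
    1+a-1+b : ∀ a b → (1# + a) - (1# + b) ≈ a - b
    1+a-1+b a b = begin
      (1# + a) + - (1# + b)    ≈⟨ +-congˡ (-‿+-comm 1# b) ⟨
      (1# + a) + (- 1# + - b)  ≈⟨ +-congʳ (+-comm 1# a) ⟩
      (a + 1#) + (- 1# + - b)  ≈⟨ +-assoc a 1# _ ⟩
      a + (1# + (- 1# + - b))  ≈⟨ +-congˡ (+-assoc 1# (- 1#) (- b)) ⟨
      a + ((1# - 1#) + - b)    ≈⟨ +-congˡ (+-congʳ (-‿inverseʳ 1#)) ⟩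
      a + (0# + - b)           ≈⟨ +-congˡ (+-identityˡ (- b)) ⟩
      a - b                    ∎

  ι-⊖ : ∀ m n → ι (m ⊖ n) ≈ natF R m - natF R n
  ι-⊖ zero    zero    = sym (-‿inverseʳ 0#)
  ι-⊖ (suc m) zero    = sym (trans (+-congˡ -0#≈0#) (+-identityʳ _))
  ι-⊖ zero    (suc n) = sym (+-identityˡ _)
  ι-⊖ (suc m) (suc n) = begin
    ι (suc m ⊖ suc n)                ≡⟨ ≡.cong ι (ℤP.[1+m]⊖[1+n]≡m⊖n m n) ⟩
    ι (m ⊖ n)                        ≈⟨ ι-⊖ m n ⟩
    natF R m - natF R n              ≈⟨ 1+a-1+b _ _ ⟨
    natF R (suc m) - natF R (suc n)  ∎

  ι-◃ : ∀ n → ι (Sign.+ ℤ.◃ n) ≈ natF R n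
  ι-◃ zero    = refl
  ι-◃ (suc n) = refl

  ι-◃- : ∀ n → ι (Sign.- ℤ.◃ n) ≈ - natF R n
  ι-◃- zero    = sym -0#≈0#
  ι-◃- (suc n) = refl

  ι-+ : ∀ i j → ι (i ℤ.+ j) ≈ ι i + ι j
  ι-+ (+ m)    (+ n)    = natF-+ m n
  ι-+ (+ m)    -[1+ n ] = ι-⊖ m (suc n)
  ι-+ -[1+ m ] (+ n)    = trans (ι-⊖ n (suc m)) (+-comm _ _)
  ι-+ -[1+ m ] -[1+ n ] = begin
    - natF R (suc (suc (m ℕ.+ n)))     ≡⟨ ≡.cong (λ k → - natF R (suc k)) (ℕP.+-suc m n) ⟨
    - natF R (suc m ℕ.+ suc n)         ≈⟨ -‿cong (natF-+ (suc m) (suc n)) ⟩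
    - (natF R (suc m) + natF R (suc n)) ≈⟨ -‿+-comm _ _ ⟨
    ι -[1+ m ] + ι -[1+ n ]            ∎

  ι-* : ∀ i j → ι (i ℤ.* j) ≈ ι i * ι j
  ι-* (+ m)    (+ n)    = trans (ι-◃ (m ℕ.* n)) (natF-* m n)
  ι-* (+ m)    -[1+ n ] = trans (ι-◃- (m ℕ.* suc n))
    (trans (-‿cong (natF-* m (suc n))) (-‿distribʳ-* _ _))
  ι-* -[1+ m ] (+ n)    = trans (ι-◃- (suc m ℕ.* n))
    (trans (-‿cong (natF-* (suc m) n)) (-‿distribˡ-* _ _))
  ι-* -[1+ m ] -[1+ n ] = begin
    ι (Sign.+ ℤ.◃ (suc m ℕ.* suc n))     ≈⟨ ι-◃ (suc m ℕ.* suc n) ⟩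
    natF R (suc m ℕ.* suc n)             ≈⟨ natF-* (suc m) (suc n) ⟩
    natF R (suc m) * natF R (suc n)      ≈⟨ -‿involutive _ ⟨
    - - (natF R (suc m) * natF R (suc n)) ≈⟨ -‿cong (-‿distribˡ-* _ _) ⟩
    - (ι -[1+ m ] * natF R (suc n))       ≈⟨ -‿distribʳ-* _ _ ⟩
    ι -[1+ m ] * ι -[1+ n ]              ∎

  ι-- : ∀ i → ι (ℤ.- i) ≈ - ι i
  ι-- (+ zero)  = sym -0#≈0#
  ι-- (+ suc n) = refl
  ι-- -[1+ n ]  = sym (-‿involutive _)

  ι-homomorphism :
    CommutativeRing.rawRing ℤP.+-*-commutativeRing -Raw-AlmostCommutative⟶ fromCommutativeRing R
  ι-homomorphism = record
    { ⟦_⟧ = ι ; +-homo = ι-+ ; *-homo = ι-* ; -‿homo = ι--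
    ; 0-homo = refl ; 1-homo = +-identityʳ 1# }

  ι-≟ : ∀ i j → Maybe (ι i ≈ ι j)
  ι-≟ i j with i ℤ.≟ j
  ... | yes ≡.refl = just refl
  ... | no _       = nothing

  open import Algebra.Solver.Ring _ (fromCommutativeRing R) ι-homomorphism ι-≟ public
    using (solve; _:+_; _:*_; _:-_; _:=_)

module Sum {c ℓ : Level} (R : CommutativeRing c ℓ) where
  open CommutativeRing R hiding (zero)
  open RingSolver R

  sumTo-cong : ∀ m {f g : ℕ → Carrier} → (∀ i → i ℕ.≤ m → f i ≈ g i) → sumTo R m f ≈ sumTo R m g
  sumTo-cong zero    f≈g = f≈g 0 z≤n
  sumTo-cong (suc m) f≈g =
    +-cong (sumTo-cong m (λ i i≤m → f≈g i (ℕP.m≤n⇒m≤1+n i≤m))) (f≈g (suc m) ℕP.≤-refl)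

  sumTo-- : ∀ m (f g : ℕ → Carrier) → sumTo R m f - sumTo R m g ≈ sumTo R m (λ i → f i - g i)
  sumTo-- zero    f g = refl
  sumTo-- (suc m) f g = trans
    (solve 4 (λ s a t b → (s :+ a) :- (t :+ b) := (s :- t) :+ (a :- b)) refl
           (sumTo R m f) (f (suc m)) (sumTo R m g) (g (suc m)))
    (+-congʳ (sumTo-- m f g))

  sumTo-0 : ∀ m (f : ℕ → Carrier) → (∀ i → i ℕ.≤ m → f i ≈ 0#) → sumTo R m f ≈ 0#
  sumTo-0 zero    f f≈0 = f≈0 0 z≤n
  sumTo-0 (suc m) f f≈0 = trans
    (+-cong (sumTo-0 m f (λ i i≤m → f≈0 i (ℕP.m≤n⇒m≤1+n i≤m))) (f≈0 (suc m) ℕP.≤-refl))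
    (+-identityʳ 0#)

  sumTo-single : ∀ m a (f : ℕ → Carrier) → a ℕ.≤ m → (∀ i → i ℕ.≤ m → i ≢ a → f i ≈ 0#) →
                 sumTo R m f ≈ f a
  sumTo-single zero    zero f z≤n _ = refl
  sumTo-single (suc m) a    f a≤m f≈0 with a ℕ.≟ suc m
  ... | yes ≡.refl = trans
    (+-congʳ (sumTo-0 m f (λ i i≤m → f≈0 i (ℕP.m≤n⇒m≤1+n i≤m) (ℕP.<⇒≢ (s≤s i≤m)))))
    (+-identityˡ _)
  ... | no a≢1+m = trans
    (+-cong (sumTo-single m a f (ℕP.≤-pred (ℕP.≤∧≢⇒< a≤m a≢1+m))
                          (λ i i≤m → f≈0 i (ℕP.m≤n⇒m≤1+n i≤m)))
            (f≈0 (suc m) ℕP.≤-refl (≢-sym a≢1+m)))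
    (+-identityʳ _)

module Polynomial {c ℓ : Level} (R : CommutativeRing c ℓ) where
  open CommutativeRing R hiding (zero)
  open import Algebra.Properties.Ring ring
  open NatCast R
  open RingSolver R

  Fun : Set c
  Fun = Carrier → Carrier

  infix 4 _≐_
  _≐_ : Fun → Fun → Set (c ⊔ ℓ)
  f ≐ g = ∀ x → f x ≈ g x

  Δ : Fun → Fun
  Δ f t = f t - f (t - 1#)

  Δ^ : ℕ → Fun → Fun
  Δ^ zero    f = f
  Δ^ (suc k) f = Δ (Δ^ k f)

  -- Degree at most d, phrased through the factor theorem instead of coefficients.
  Deg≤ : ℕ → Fun → Set (c ⊔ ℓ)
  Deg≤ zero    f = ∀ x y → f x ≈ f y
  Deg≤ (suc d) f = ∀ r → ∃ λ g → Deg≤ d g × (∀ x → f x ≈ f r + (x - r) * g x)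

  deg≤-cong : ∀ d {f g} → Deg≤ d f → f ≐ g → Deg≤ d g
  deg≤-cong zero    f≤ f≐g x y = trans (sym (f≐g x)) (trans (f≤ x y) (f≐g y))
  deg≤-cong (suc d) f≤ f≐g r with f≤ r
  ... | g , g≤ , eq = g , g≤ , λ x → trans (sym (f≐g x)) (trans (eq x) (+-congʳ (f≐g r)))

  deg≤-const : ∀ d k → Deg≤ d (λ _ → k)
  deg≤-const zero    k x y = refl
  deg≤-const (suc d) k r = (λ _ → 0#) , deg≤-const d 0# , λ x →
    sym (trans (+-congˡ (zeroʳ _)) (+-identityʳ k))

  deg≤-suc : ∀ d {f} → Deg≤ d f → Deg≤ (suc d) f
  deg≤-suc zero    f≤ r = (λ _ → 0#) , deg≤-const zero 0# , λ x →
    trans (f≤ x r) (sym (trans (+-congˡ (zeroʳ _)) (+-identityʳ _)))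
  deg≤-suc (suc d) f≤ r with f≤ r
  ... | g , g≤ , eq = g , deg≤-suc d g≤ , eq

  deg≤-mono : ∀ {d e f} → d ℕ.≤ e → Deg≤ d f → Deg≤ e f
  deg≤-mono d≤e = go (ℕP.≤⇒≤′ d≤e)
    where
    go : ∀ {d e f} → d ℕ.≤′ e → Deg≤ d f → Deg≤ e f
    go ℕ.≤′-refl        f≤ = f≤
    go (ℕ.≤′-step d≤′e) f≤ = deg≤-suc _ (go d≤′e f≤)

  deg≤-+ : ∀ d {f f′} → Deg≤ d f → Deg≤ d f′ → Deg≤ d (λ x → f x + f′ x)
  deg≤-+ zero    f≤ f′≤ x y = +-cong (f≤ x y) (f′≤ x y)
  deg≤-+ (suc d) {f} {f′} f≤ f′≤ r with f≤ r | f′≤ r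
  ... | g , g≤ , eq | g′ , g′≤ , eq′ = (λ x → g x + g′ x) , deg≤-+ d g≤ g′≤ , λ x →
    trans (+-cong (eq x) (eq′ x))
      (solve 5 (λ a u b a′ b′ → (a :+ u :* b) :+ (a′ :+ u :* b′) := (a :+ a′) :+ u :* (b :+ b′))
             refl (f r) (x - r) (g x) (f′ r) (g′ x))

  deg≤-*ˡ : ∀ d k {f} → Deg≤ d f → Deg≤ d (λ x → k * f x)
  deg≤-*ˡ zero    k f≤ x y = *-congˡ (f≤ x y)
  deg≤-*ˡ (suc d) k {f} f≤ r with f≤ r
  ... | g , g≤ , eq = (λ x → k * g x) , deg≤-*ˡ d k g≤ , λ x →
    trans (*-congˡ (eq x))
      (solve 4 (λ k a u b → k :* (a :+ u :* b) := k :* a :+ u :* (k :* b)) refl k (f r) (x - r) (g x))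

  deg≤-*ʳ : ∀ d k {f} → Deg≤ d f → Deg≤ d (λ x → f x * k)
  deg≤-*ʳ d k f≤ = deg≤-cong d (deg≤-*ˡ d k f≤) (λ _ → *-comm _ _)

  deg≤-- : ∀ d {f f′} → Deg≤ d f → Deg≤ d f′ → Deg≤ d (λ x → f x - f′ x)
  deg≤-- d f≤ f′≤ = deg≤-+ d f≤ (deg≤-cong d (deg≤-*ˡ d (- 1#) f′≤) (λ _ → -1*x≈-x _))

  deg≤-shift : ∀ d t {f} → Deg≤ d f → Deg≤ d (λ x → f (x + t))
  deg≤-shift zero    t f≤ x y = f≤ _ _
  deg≤-shift (suc d) t {f} f≤ r with f≤ (r + t)
  ... | g , g≤ , eq = (λ x → g (x + t)) , deg≤-shift d t g≤ , λ x →
    trans (eq (x + t)) (+-congˡ (*-congʳ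
      (solve 3 (λ x t r → (x :+ t) :- (r :+ t) := x :- r) refl x t r)))

  deg≤-*-linear : ∀ d s {f} → Deg≤ d f → Deg≤ (suc d) (λ x → f x * (x + s))
  deg≤-*-linear zero    s {f} f≤ r = f , f≤ , λ x →
    trans (solve 4 (λ a x s r → a :* (x :+ s) := a :* (r :+ s) :+ (x :- r) :* a) refl (f x) x s r)
          (+-congʳ (*-congʳ (f≤ x r)))
  deg≤-*-linear (suc d) s {f} f≤ r with f≤ r
  ... | g , g≤ , eq = (λ x → f x + (r + s) * g x) ,
    deg≤-+ (suc d) f≤ (deg≤-*ˡ (suc d) (r + s) (deg≤-suc d g≤)) , λ x →
    trans (*-congʳ (eq x)) (trans
      (solve 5 (λ a x r b s → (a :+ (x :- r) :* b) :* (x :+ s)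
                  := a :* (r :+ s) :+ (x :- r) :* ((a :+ (x :- r) :* b) :+ (r :+ s) :* b))
             refl (f r) x r (g x) s)
      (+-congˡ (*-congˡ (+-congʳ (sym (eq x))))))

  Δ-factor : ∀ {f g} r → (∀ x → f x ≈ f r + (x - r) * g x) →
             ∀ x → Δ f x ≈ g (x - 1#) + (x - r) * Δ g x
  Δ-factor {f} {g} r eq x = trans (+-cong (eq x) (-‿cong (eq (x - 1#)))) (trans
    (solve 6 (λ a x r b o b′ → (a :+ (x :- r) :* b) :- (a :+ ((x :- o) :- r) :* b′)
                := o :* b′ :+ (x :- r) :* (b :- b′)) refl (f r) x r (g x) 1# (g (x - 1#)))
    (+-congʳ (*-identityˡ _)))

  deg≤0⇒Δ≈0 : ∀ {f} → Deg≤ zero f → Δ f ≐ λ _ → 0#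
  deg≤0⇒Δ≈0 f≤ x = x≈y⇒x∙y⁻¹≈ε (f≤ x (x - 1#))

  deg≤-Δ : ∀ d {f} → Deg≤ (suc d) f → Deg≤ d (Δ f)
  deg≤-Δ zero {f} f≤ with f≤ 0#
  ... | g , g≤ , eq = λ x y → trans (Δf≈ x) (trans (g≤ _ _) (sym (Δf≈ y)))
    where
    Δf≈ : ∀ x → Δ f x ≈ g (x - 1#)
    Δf≈ x = trans (Δ-factor 0# eq x)
      (trans (+-congˡ (trans (*-congˡ (deg≤0⇒Δ≈0 g≤ x)) (zeroʳ _))) (+-identityʳ _))
  deg≤-Δ (suc d) {f} f≤ with f≤ 0#
  ... | g , g≤ , eq = deg≤-cong (suc d)
    (deg≤-+ (suc d) (deg≤-shift (suc d) (- 1#) g≤)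
      (deg≤-cong (suc d) (deg≤-*-linear d (- 0#) (deg≤-Δ d g≤)) (λ _ → *-comm _ _)))
    (λ x → sym (Δ-factor 0# eq x))

  deg≤-Δ-pred : ∀ d {f} → Deg≤ d f → Deg≤ (ℕ.pred d) (Δ f)
  deg≤-Δ-pred zero    f≤ = deg≤-cong zero (deg≤-const zero 0#) (λ x → sym (deg≤0⇒Δ≈0 f≤ x))
  deg≤-Δ-pred (suc d) f≤ = deg≤-Δ d f≤

  deg≤⇒cong : ∀ d {f x y} → Deg≤ d f → x ≈ y → f x ≈ f y
  deg≤⇒cong zero    f≤ _   = f≤ _ _
  deg≤⇒cong (suc d) {f} {x} {y} f≤ x≈y with f≤ x
  ... | g , _ , eq = sym (trans (eq y)
    (trans (+-congˡ (trans (*-congʳ (x≈y⇒x∙y⁻¹≈ε (sym x≈y))) (zeroˡ _))) (+-identityʳ _)))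

  deg≤-pow : ∀ k → Deg≤ k (λ x → pow R x k)
  deg≤-pow zero    = deg≤-const zero 1#
  deg≤-pow (suc k) =
    deg≤-cong (suc k) (deg≤-*-linear k 0# (deg≤-pow k)) (λ x → *-congˡ (+-identityʳ x))

  deg≤-rising : ∀ k → Deg≤ k (λ x → rising R x k)
  deg≤-rising zero    = deg≤-const zero 1#
  deg≤-rising (suc k) = deg≤-*-linear k (natF R k) (deg≤-rising k)

  deg≤-sumTo : ∀ d m (F : ℕ → Fun) → (∀ i → i ℕ.≤ m → Deg≤ d (F i)) →
               Deg≤ d (λ x → sumTo R m (λ i → F i x))
  deg≤-sumTo d zero    F F≤ = F≤ 0 z≤n
  deg≤-sumTo d (suc m) F F≤ =
    deg≤-+ d (deg≤-sumTo d m F (λ i i≤m → F≤ i (ℕP.m≤n⇒m≤1+n i≤m))) (F≤ (suc m) ℕP.≤-refl)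

  deg≤-sumFin : ∀ d k (F : Fin k → Fun) → (∀ i → Deg≤ d (F i)) →
                Deg≤ d (λ x → sumFin R (λ i → F i x))
  deg≤-sumFin d zero    F F≤ = deg≤-const d 0#
  deg≤-sumFin d (suc k) F F≤ =
    deg≤-+ d (F≤ Fin.zero) (deg≤-sumFin d k (λ i → F (Fin.suc i)) (λ i → F≤ (Fin.suc i)))

  Δ-cong : ∀ {f g} → f ≐ g → Δ f ≐ Δ g
  Δ-cong f≐g x = +-cong (f≐g x) (-‿cong (f≐g (x - 1#)))

  Δ^-cong : ∀ k {f g} → f ≐ g → Δ^ k f ≐ Δ^ k g
  Δ^-cong zero    f≐g = f≐g
  Δ^-cong (suc k) f≐g = Δ-cong (Δ^-cong k f≐g)

  Δ^-Δ : ∀ k f → Δ^ k (Δ f) ≐ Δ (Δ^ k f)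
  Δ^-Δ zero    f x = refl
  Δ^-Δ (suc k) f   = Δ-cong (Δ^-Δ k f)

  Δ^-*ˡ : ∀ k a f → Δ^ k (λ x → a * f x) ≐ (λ x → a * Δ^ k f x)
  Δ^-*ˡ zero    a f x = refl
  Δ^-*ˡ (suc k) a f x = trans (Δ-cong (Δ^-*ˡ k a f) x) (sym (x[y-z]≈xy-xz a _ _))

  rising-pred : ∀ t k → rising R (t - 1#) (suc k) ≈ (t - 1#) * rising R t k
  rising-pred t zero    = trans (*-identityˡ _) (trans (+-identityʳ _) (sym (*-identityʳ _)))
  rising-pred t (suc k) = trans
    (*-cong (rising-pred t k)
            (solve 3 (λ t o n → (t :- o) :+ (o :+ n) := t :+ n) refl t 1# (natF R k)))
    (*-assoc _ _ _)

  Δ-rising : ∀ k → Δ (λ t → rising R t k) ≐ (λ t → natF R k * rising R t (ℕ.pred k))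
  Δ-rising zero    t = trans (-‿inverseʳ 1#) (sym (zeroˡ _))
  Δ-rising (suc k) t = trans (+-congˡ (-‿cong (rising-pred t k)))
    (solve 4 (λ r t n o → r :* (t :+ n) :- (t :- o) :* r := (o :+ n) :* r)
             refl (rising R t k) t (natF R k) 1#)

  Δ^-rising : ∀ a i → Δ^ (suc a) (λ t → rising R t i) ≐
                      (λ t → natF R i * Δ^ a (λ t → rising R t (ℕ.pred i)) t)
  Δ^-rising a i t =
    trans (sym (Δ^-Δ a _ t)) (trans (Δ^-cong a (Δ-rising i) t) (Δ^-*ˡ a (natF R i) _ t))

  rising-0 : ∀ k → rising R 0# (suc k) ≈ 0#
  rising-0 zero    = trans (*-identityˡ _) (+-identityʳ _)
  rising-0 (suc k) = trans (*-congʳ (rising-0 k)) (zeroˡ _)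

  Δ^-rising-0-≡ : ∀ a → Δ^ a (λ t → rising R t a) 0# ≈ natF R (a !)
  Δ^-rising-0-≡ zero    = sym (+-identityʳ 1#)
  Δ^-rising-0-≡ (suc a) = trans (Δ^-rising a (suc a) 0#)
    (trans (*-congˡ (Δ^-rising-0-≡ a)) (sym (natF-* (suc a) (a !))))

  Δ^-rising-0-≢ : ∀ a i → i ≢ a → Δ^ a (λ t → rising R t i) 0# ≈ 0#
  Δ^-rising-0-≢ zero    zero    i≢a = ⊥-elim (i≢a ≡.refl)
  Δ^-rising-0-≢ zero    (suc i) _   = rising-0 i
  Δ^-rising-0-≢ (suc a) zero    _   = trans (Δ^-rising a zero 0#) (zeroˡ _)
  Δ^-rising-0-≢ (suc a) (suc i) i≢a = trans (Δ^-rising a (suc i) 0#)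
    (trans (*-congˡ (Δ^-rising-0-≢ a i (λ i≡a → i≢a (≡.cong suc i≡a)))) (zeroʳ _))

module Bivariate {c ℓ : Level} (R : CommutativeRing c ℓ) where
  open CommutativeRing R hiding (zero)
  open import Algebra.Properties.Ring ring
  open RingSolver R
  open import Relation.Binary.Reasoning.Setoid setoid
  open Sum R
  open Polynomial R

  Fun² : Set c
  Fun² = Point R → Carrier

  infix 4 _≐²_
  _≐²_ : Fun² → Fun² → Set (c ⊔ ℓ)
  f ≐² g = ∀ p → f p ≈ g p

  Δx^ Δy^ : ℕ → Fun² → Fun²
  Δx^ k = iter R k (Δx R)
  Δy^ k = iter R k (Δy R)

  Δxy^ : ℕ → ℕ → Fun² → Fun²
  Δxy^ a b f = Δx^ a (Δy^ b f)

  iter-+ : ∀ D a b (f : Fun²) → iter R a D (iter R b D f) ≡ iter R (a ℕ.+ b) D f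
  iter-+ D zero    b f = ≡.refl
  iter-+ D (suc a) b f = ≡.cong D (iter-+ D a b f)

  module Difference (σ : Point R → Point R) (D : Fun² → Fun²)
                    (D-def : ∀ f p → D f p ≈ f p - f (σ p)) where

    D-cong : ∀ {f g} → f ≐² g → D f ≐² D g
    D-cong {f} {g} f≐g p =
      trans (D-def f p) (trans (+-cong (f≐g p) (-‿cong (f≐g (σ p)))) (sym (D-def g p)))

    iter-cong : ∀ k {f g} → f ≐² g → iter R k D f ≐² iter R k D g
    iter-cong zero    f≐g = f≐g
    iter-cong (suc k) f≐g = D-cong (iter-cong k f≐g)

    iter-D : ∀ k f → iter R k D (D f) ≐² D (iter R k D f)
    iter-D zero    f p = refl
    iter-D (suc k) f   = D-cong (iter-D k f)

    iter-*ˡ : ∀ k a f → iter R k D (λ p → a * f p) ≐² (λ p → a * iter R k D f p)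
    iter-*ˡ zero    a f p = refl
    iter-*ˡ (suc k) a f p = trans (D-cong (iter-*ˡ k a f) p)
      (trans (D-def _ p) (trans (sym (x[y-z]≈xy-xz a _ _)) (*-congˡ (sym (D-def _ p)))))

    iter-- : ∀ k f g → iter R k D (λ p → f p - g p) ≐² (λ p → iter R k D f p - iter R k D g p)
    iter-- zero    f g p = refl
    iter-- (suc k) f g p = trans (D-cong (iter-- k f g) p) (trans (D-def _ p) (trans
      (solve 4 (λ a b a′ b′ → (a :- b) :- (a′ :- b′) := (a :- a′) :- (b :- b′)) refl
             (iter R k D f p) (iter R k D g p) (iter R k D f (σ p)) (iter R k D g (σ p)))
      (sym (+-cong (D-def _ p) (-‿cong (D-def _ p))))))

    iter-sumTo : ∀ k m (F : ℕ → Fun²) →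
      iter R k D (λ p → sumTo R m (λ i → F i p)) ≐² (λ p → sumTo R m (λ i → iter R k D (F i) p))
    iter-sumTo zero    m F p = refl
    iter-sumTo (suc k) m F p = trans (D-cong (iter-sumTo k m F) p)
      (trans (D-def _ p) (trans (sumTo-- m _ _) (sumTo-cong m (λ i _ → sym (D-def _ p)))))

    iter-sumTo² : ∀ k m n (T : ℕ → ℕ → Fun²) →
      iter R k D (λ p → sumTo R m (λ i → sumTo R n (λ j → T i j p))) ≐²
      (λ p → sumTo R m (λ i → sumTo R n (λ j → iter R k D (T i j) p)))
    iter-sumTo² k m n T p = trans (iter-sumTo k m _ p) (sumTo-cong m (λ i _ → iter-sumTo k n (T i) p))

  module X = Difference (λ p → proj₁ p - 1# , proj₂ p) (Δx R) (λ _ _ → refl)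
  module Y = Difference (λ p → proj₁ p , proj₂ p - 1#) (Δy R) (λ _ _ → refl)

  Δxy^-*ˡ : ∀ a b k f → Δxy^ a b (λ p → k * f p) ≐² (λ p → k * Δxy^ a b f p)
  Δxy^-*ˡ a b k f p = trans (X.iter-cong a (Y.iter-*ˡ b k f) p) (X.iter-*ˡ a k _ p)

  Δxy^-- : ∀ a b f g → Δxy^ a b (λ p → f p - g p) ≐² (λ p → Δxy^ a b f p - Δxy^ a b g p)
  Δxy^-- a b f g p = trans (X.iter-cong a (Y.iter-- b f g) p) (X.iter-- a _ _ p)

  Δxy^-sumTo² : ∀ a b m n (T : ℕ → ℕ → Fun²) →
    Δxy^ a b (λ p → sumTo R m (λ i → sumTo R n (λ j → T i j p))) ≐²
    (λ p → sumTo R m (λ i → sumTo R n (λ j → Δxy^ a b (T i j) p)))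
  Δxy^-sumTo² a b m n T p = trans (X.iter-cong a (Y.iter-sumTo² b m n T) p) (X.iter-sumTo² a m n _ p)

  Δy-Δx : ∀ f → Δy R (Δx R f) ≐² Δx R (Δy R f)
  Δy-Δx f p = solve 4 (λ a b c d → (a :- b) :- (c :- d) := (a :- c) :- (b :- d)) refl _ _ _ _

  Δy^-Δx : ∀ b f → Δy^ b (Δx R f) ≐² Δx R (Δy^ b f)
  Δy^-Δx zero    f p = refl
  Δy^-Δx (suc b) f p = trans (Y.D-cong (Δy^-Δx b f) p) (Δy-Δx (Δy^ b f) p)

  Δy^-Δx^ : ∀ b a f → Δy^ b (Δx^ a f) ≐² Δx^ a (Δy^ b f)
  Δy^-Δx^ b zero    f p = refl
  Δy^-Δx^ b (suc a) f p = trans (Δy^-Δx b (Δx^ a f) p) (X.D-cong (Δy^-Δx^ b a f) p)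

  Δxy^-Δxy^ : ∀ a b i j f → Δxy^ a b (Δxy^ i j f) ≐² Δxy^ (a ℕ.+ i) (b ℕ.+ j) f
  Δxy^-Δxy^ a b i j f p = trans (X.iter-cong a (Δy^-Δx^ b i _) p) (reflexive (≡.cong (λ g → g p)
    (≡.trans (iter-+ (Δx R) a i _) (≡.cong (Δx^ (a ℕ.+ i)) (iter-+ (Δy R) b j f)))))

  Δx^-section : ∀ a f x y → Δx^ a f (x , y) ≈ Δ^ a (λ x′ → f (x′ , y)) x
  Δx^-section zero    f x y = refl
  Δx^-section (suc a) f x y = +-cong (Δx^-section a f x y) (-‿cong (Δx^-section a f (x - 1#) y))

  Δy^-section : ∀ b f x y → Δy^ b f (x , y) ≈ Δ^ b (λ y′ → f (x , y′)) y
  Δy^-section zero    f x y = refl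
  Δy^-section (suc b) f x y = +-cong (Δy^-section b f x y) (-‿cong (Δy^-section b f x (y - 1#)))

  Δxy^-separable : ∀ a b (u v : Fun) →
    Δxy^ a b (λ p → u (proj₁ p) * v (proj₂ p)) ≐² (λ p → Δ^ a u (proj₁ p) * Δ^ b v (proj₂ p))
  Δxy^-separable a b u v (x , y) = begin
    Δxy^ a b (λ p → u (proj₁ p) * v (proj₂ p)) (x , y)      ≈⟨ Δx^-section a _ x y ⟩
    Δ^ a (λ x′ → Δy^ b (λ p → u (proj₁ p) * v (proj₂ p)) (x′ , y)) x
      ≈⟨ Δ^-cong a (λ x′ → trans (Δy^-section b _ x′ y) (Δ^-*ˡ b (u x′) v y)) x ⟩
    Δ^ a (λ x′ → u x′ * Δ^ b v y) x                          ≈⟨ Δ^-cong a (λ _ → *-comm _ _) x ⟩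
    Δ^ a (λ x′ → Δ^ b v y * u x′) x                          ≈⟨ Δ^-*ˡ a (Δ^ b v y) u x ⟩
    Δ^ b v y * Δ^ a u x                                      ≈⟨ *-comm _ _ ⟩
    Δ^ a u x * Δ^ b v y                                      ∎

  Deg≤² : ℕ → ℕ → Fun² → Set (c ⊔ ℓ)
  Deg≤² m n f = (∀ y → Deg≤ m (λ x → f (x , y))) × (∀ x → Deg≤ n (λ y → f (x , y)))

  deg≤²-*ˡ : ∀ m n k {f} → Deg≤² m n f → Deg≤² m n (λ p → k * f p)
  deg≤²-*ˡ m n k (fˣ , fʸ) = (λ y → deg≤-*ˡ m k (fˣ y)) , (λ x → deg≤-*ˡ n k (fʸ x))

  deg≤²-- : ∀ m n {f g} → Deg≤² m n f → Deg≤² m n g → Deg≤² m n (λ p → f p - g p)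
  deg≤²-- m n (fˣ , fʸ) (gˣ , gʸ) = (λ y → deg≤-- m (fˣ y) (gˣ y)) , (λ x → deg≤-- n (fʸ x) (gʸ x))

  deg≤²-Δx : ∀ m n {f} → Deg≤² m n f → Deg≤² (ℕ.pred m) n (Δx R f)
  deg≤²-Δx m n (fˣ , fʸ) = (λ y → deg≤-Δ-pred m (fˣ y)) , (λ x → deg≤-- n (fʸ x) (fʸ (x - 1#)))

  deg≤²-Δy : ∀ m n {f} → Deg≤² m n f → Deg≤² m (ℕ.pred n) (Δy R f)
  deg≤²-Δy m n (fˣ , fʸ) = (λ y → deg≤-- m (fˣ y) (fˣ (y - 1#))) , (λ x → deg≤-Δ-pred n (fʸ x))

  deg≤²-Δx^ : ∀ m n a {f} → Deg≤² m n f → Deg≤² (m ∸ a) n (Δx^ a f)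
  deg≤²-Δx^ m n zero    f≤ = f≤
  deg≤²-Δx^ m n (suc a) {f} f≤ =
    ≡.subst (λ e → Deg≤² e n (Δx^ (suc a) f)) (ℕP.pred[m∸n]≡m∸[1+n] m a)
      (deg≤²-Δx (m ∸ a) n (deg≤²-Δx^ m n a f≤))

  deg≤²-Δy^ : ∀ m n b {f} → Deg≤² m n f → Deg≤² m (n ∸ b) (Δy^ b f)
  deg≤²-Δy^ m n zero    f≤ = f≤
  deg≤²-Δy^ m n (suc b) {f} f≤ =
    ≡.subst (λ e → Deg≤² m e (Δy^ (suc b) f)) (ℕP.pred[m∸n]≡m∸[1+n] n b)
      (deg≤²-Δy m (n ∸ b) (deg≤²-Δy^ m n b f≤))

  deg≤²-Δxy^ : ∀ m n a b {f} → Deg≤² m n f → Deg≤² (m ∸ a) (n ∸ b) (Δxy^ a b f)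
  deg≤²-Δxy^ m n a b f≤ = deg≤²-Δx^ m (n ∸ b) a (deg≤²-Δy^ m n b f≤)

  deg≤²⇒cong : ∀ m n {f x x′ y y′} → Deg≤² m n f → x ≈ x′ → y ≈ y′ → f (x , y) ≈ f (x′ , y′)
  deg≤²⇒cong m n (fˣ , fʸ) x≈x′ y≈y′ = trans (deg≤⇒cong m (fˣ _) x≈x′) (deg≤⇒cong n (fʸ _) y≈y′)

  deg≤²-eval : ∀ {m n} (p : Poly R m n) → Deg≤² m n (eval R p)
  deg≤²-eval {m} {n} p =
    (λ y → deg≤-sumFin m (suc m) _ (λ k → deg≤-sumFin m (suc n) _ (λ l →
      deg≤-*ˡ m (p k l) (deg≤-*ʳ m (pow R y (toℕ l))
        (deg≤-mono (FinP.toℕ≤pred[n] k) (deg≤-pow (toℕ k))))))) ,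
    (λ x → deg≤-sumFin n (suc m) _ (λ k → deg≤-sumFin n (suc n) _ (λ l →
      deg≤-*ˡ n (p k l) (deg≤-*ˡ n (pow R x (toℕ k))
        (deg≤-mono (FinP.toℕ≤pred[n] l) (deg≤-pow (toℕ l)))))))

  shift : Carrier → Carrier → Fun² → Fun²
  shift b c f p = f (proj₁ p + b , proj₂ p + c)

  deg≤²-shift : ∀ m n b c {f} → Deg≤² m n f → Deg≤² m n (shift b c f)
  deg≤²-shift m n b c (fˣ , fʸ) =
    (λ y → deg≤-shift m b (fˣ (y + c))) , (λ x → deg≤-shift n c (fʸ (x + b)))

  private
    -1+ : ∀ x b → (x - 1#) + b ≈ (x + b) - 1#
    -1+ x b = solve 3 (λ x o b → (x :- o) :+ b := (x :+ b) :- o) refl x 1# b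

  Δx^-shift : ∀ m n a b c {f} → Deg≤² m n f → Δx^ a (shift b c f) ≐² shift b c (Δx^ a f)
  Δx^-shift m n zero    b c f≤ p = refl
  Δx^-shift m n (suc a) b c f≤ p = trans (X.D-cong (Δx^-shift m n a b c f≤) p)
    (+-congˡ (-‿cong (deg≤²⇒cong (m ∸ a) n (deg≤²-Δx^ m n a f≤) (-1+ _ b) refl)))

  Δy^-shift : ∀ m n a b c {f} → Deg≤² m n f → Δy^ a (shift b c f) ≐² shift b c (Δy^ a f)
  Δy^-shift m n zero    b c f≤ p = refl
  Δy^-shift m n (suc a) b c f≤ p = trans (Y.D-cong (Δy^-shift m n a b c f≤) p)
    (+-congˡ (-‿cong (deg≤²⇒cong m (n ∸ a) (deg≤²-Δy^ m n a f≤) refl (-1+ _ c))))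

  Δxy^-shift : ∀ m n a a′ b c {f} → Deg≤² m n f → Δxy^ a a′ (shift b c f) ≐² shift b c (Δxy^ a a′ f)
  Δxy^-shift m n a a′ b c f≤ p = trans (X.iter-cong a (Δy^-shift m n a′ b c f≤) p)
    (Δx^-shift m (n ∸ a′) a b c (deg≤²-Δy^ m n a′ f≤) p)

  module _ (m n : ℕ) (K : ℕ → ℕ → Carrier) where

    newtonSum : Fun²
    newtonSum (x , y) = sumTo R m (λ i → sumTo R n (λ j → K i j * rising R x i * rising R y j))

    deg≤²-newtonSum : Deg≤² m n newtonSum
    deg≤²-newtonSum =
      (λ y → deg≤-sumTo m m _ (λ i i≤m → deg≤-sumTo m n _ (λ j _ →
        deg≤-*ʳ m (rising R y j) (deg≤-*ˡ m (K i j) (deg≤-mono i≤m (deg≤-rising i)))))) ,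
      (λ x → deg≤-sumTo n m _ (λ i _ → deg≤-sumTo n n _ (λ j j≤n →
        deg≤-*ˡ n (K i j * rising R x i) (deg≤-mono j≤n (deg≤-rising j)))))

    Δxy^-newtonSum-0 : ∀ a b → a ℕ.≤ m → b ℕ.≤ n →
      Δxy^ a b newtonSum (0# , 0#) ≈ K a b * natF R (a !) * natF R (b !)
    Δxy^-newtonSum-0 a b a≤m b≤n = begin
      Δxy^ a b newtonSum (0# , 0#)                        ≈⟨ Δxy^-sumTo² a b m n _ (0# , 0#) ⟩
      sumTo R m (λ i → sumTo R n (λ j → term i j))        ≈⟨ sumTo-single m a _ a≤m off-a ⟩
      sumTo R n (λ j → term a j)                          ≈⟨ sumTo-single n b _ b≤n off-b ⟩
      term a b                                            ≈⟨ term≈ a b ⟩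
      K a b * Δ^ a (λ t → rising R t a) 0# * Δ^ b (λ t → rising R t b) 0#
        ≈⟨ *-cong (*-congˡ (Δ^-rising-0-≡ a)) (Δ^-rising-0-≡ b) ⟩
      K a b * natF R (a !) * natF R (b !)                 ∎
      where
      term : ℕ → ℕ → Carrier
      term i j = Δxy^ a b (λ p → K i j * rising R (proj₁ p) i * rising R (proj₂ p) j) (0# , 0#)
      term≈ : ∀ i j → term i j ≈ K i j * Δ^ a (λ t → rising R t i) 0# * Δ^ b (λ t → rising R t j) 0#
      term≈ i j = trans
        (Δxy^-separable a b (λ x → K i j * rising R x i) (λ y → rising R y j) (0# , 0#))
        (*-congʳ (Δ^-*ˡ a (K i j) _ 0#))
      off-a : ∀ i → i ℕ.≤ m → i ≢ a → sumTo R n (λ j → term i j) ≈ 0#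
      off-a i _ i≢a = sumTo-0 n _ (λ j _ → trans (term≈ i j)
        (trans (*-congʳ (trans (*-congˡ (Δ^-rising-0-≢ a i i≢a)) (zeroʳ _))) (zeroˡ _)))
      off-b : ∀ j → j ℕ.≤ n → j ≢ b → term a j ≈ 0#
      off-b j _ j≢b = trans (term≈ a j) (trans (*-congˡ (Δ^-rising-0-≢ b j j≢b)) (zeroʳ _))

module Interpolation {c ℓ : Level} (R : CommutativeRing c ℓ) (isField : IsField R) (charZero : CharZero R)
  where
  open CommutativeRing R hiding (zero)
  open import Algebra.Properties.Ring ring
  open import Relation.Binary.Reasoning.Setoid setoid
  open IsField isField
  open RingSolver R
  open Polynomial R
  open Bivariate R

  *-cancelˡ : ∀ {x y z} → ¬ x ≈ 0# → x * y ≈ x * z → y ≈ z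
  *-cancelˡ {x} {y} {z} x≉0 xy≈xz with inverse x x≉0
  ... | u , xu≈1 = begin
    y             ≈⟨ *-identityˡ y ⟨
    1# * y        ≈⟨ *-congʳ (trans (sym xu≈1) (*-comm x u)) ⟩
    (u * x) * y   ≈⟨ *-assoc u x y ⟩
    u * (x * y)   ≈⟨ *-congˡ xy≈xz ⟩
    u * (x * z)   ≈⟨ *-assoc u x z ⟨
    (u * x) * z   ≈⟨ *-congʳ (trans (*-comm u x) xu≈1) ⟩
    1# * z        ≈⟨ *-identityˡ z ⟩
    z             ∎

  natF-injective : ∀ {i j} → natF R i ≈ natF R j → i ≡ j
  natF-injective {zero}  {j}     e = ≡.sym (charZero j (sym e))
  natF-injective {suc i} {zero}  e = charZero (suc i) e
  natF-injective {suc i} {suc j} e = ≡.cong suc (natF-injective (+-cancelˡ 1# _ _ e))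

  deg≤-roots⇒≈0 : ∀ d {f} → Deg≤ d f → (ρ : ℕ → Carrier) → (∀ {i j} → ρ i ≈ ρ j → i ≡ j) →
                  (∀ k → f (ρ k) ≈ 0#) → f ≐ (λ _ → 0#)
  deg≤-roots⇒≈0 zero    f≤ ρ ρ-inj fρ≈0 x = trans (f≤ x (ρ 0)) (fρ≈0 0)
  deg≤-roots⇒≈0 (suc d) {f} f≤ ρ ρ-inj fρ≈0 x with f≤ (ρ 0)
  ... | g , g≤ , eq =
    trans (eq x) (trans (+-cong (fρ≈0 0) (trans (*-congˡ (g≈0 x)) (zeroʳ _))) (+-identityʳ 0#))
    where
    gρ≈0 : ∀ k → g (ρ (suc k)) ≈ 0#
    gρ≈0 k = *-cancelˡ (λ ρ≈ρ₀ → ℕP.1+n≢0 (ρ-inj (x∙y⁻¹≈ε⇒x≈y _ _ ρ≈ρ₀))) (begin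
      (ρ (suc k) - ρ 0) * g (ρ (suc k))        ≈⟨ +-identityˡ _ ⟨
      0# + (ρ (suc k) - ρ 0) * g (ρ (suc k))   ≈⟨ +-congʳ (fρ≈0 0) ⟨
      f (ρ 0) + (ρ (suc k) - ρ 0) * g (ρ (suc k)) ≈⟨ eq (ρ (suc k)) ⟨
      f (ρ (suc k))                            ≈⟨ fρ≈0 (suc k) ⟩
      0#                                       ≈⟨ zeroʳ _ ⟨
      (ρ (suc k) - ρ 0) * 0#                   ∎)
    g≈0 : g ≐ (λ _ → 0#)
    g≈0 = deg≤-roots⇒≈0 d g≤ (λ k → ρ (suc k)) (λ ρ≈ → ℕP.suc-injective (ρ-inj ρ≈)) gρ≈0

  Δ≈0⇒const : ∀ d {f} → Deg≤ d f → Δ f ≐ (λ _ → 0#) → ∀ x w → f x ≈ f w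
  Δ≈0⇒const d {f} f≤ Δf≈0 x w = x∙y⁻¹≈ε⇒x≈y _ _
    (deg≤-roots⇒≈0 d (deg≤-- d f≤ (deg≤-const d (f w))) (λ k → w - natF R k) below-inj
      (λ k → x≈y⇒x∙y⁻¹≈ε (f-below k)) x)
    where
    below-inj : ∀ {i j} → w - natF R i ≈ w - natF R j → i ≡ j
    below-inj e = natF-injective (-‿injective (+-cancelˡ w _ _ e))
    f-below : ∀ k → f (w - natF R k) ≈ f w
    f-below zero    = deg≤⇒cong d f≤ (trans (+-congˡ -0#≈0#) (+-identityʳ w))
    f-below (suc k) = begin
      f (w - natF R (suc k))
        ≈⟨ deg≤⇒cong d f≤ (solve 3 (λ w o n → w :- (o :+ n) := (w :- n) :- o)
                                   refl w 1# (natF R k)) ⟩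
      f ((w - natF R k) - 1#)   ≈⟨ x∙y⁻¹≈ε⇒x≈y _ _ (Δf≈0 (w - natF R k)) ⟨
      f (w - natF R k)          ≈⟨ f-below k ⟩
      f w                       ∎

  deg≤-Δ^-nodes⇒≈0 : ∀ d {f} → Deg≤ d f → (w : ℕ → Carrier) →
                     (∀ a → a ℕ.≤ d → Δ^ a f (w a) ≈ 0#) → f ≐ (λ _ → 0#)
  deg≤-Δ^-nodes⇒≈0 zero    f≤ w Δf≈0 x = trans (f≤ x (w 0)) (Δf≈0 0 z≤n)
  deg≤-Δ^-nodes⇒≈0 (suc d) {f} f≤ w Δf≈0 x =
    trans (Δ≈0⇒const (suc d) f≤ Δf≐0 x (w 0)) (Δf≈0 0 z≤n)
    where
    Δf≐0 : Δ f ≐ (λ _ → 0#)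
    Δf≐0 = deg≤-Δ^-nodes⇒≈0 d (deg≤-Δ d f≤) (λ a → w (suc a))
      (λ a a≤d → trans (Δ^-Δ a f (w (suc a))) (Δf≈0 (suc a) (s≤s a≤d)))

  private
    x-const⇒≈0 : ∀ n {f} → (∀ x → Deg≤ n (λ y → f (x , y))) → (∀ x x′ y → f (x , y) ≈ f (x′ , y)) →
                 (W : ℕ → Point R) → (∀ b → b ℕ.≤ n → Δy^ b f (W b) ≈ 0#) → f ≐² (λ _ → 0#)
    x-const⇒≈0 n {f} fʸ f-const W Δf≈0 (x , y) = trans (f-const x 0# y)
      (deg≤-Δ^-nodes⇒≈0 n (fʸ 0#) (λ b → proj₂ (W b)) Δf₀≈0 y)
      where
      Δf₀≈0 : ∀ b → b ℕ.≤ n → Δ^ b (λ y → f (0# , y)) (proj₂ (W b)) ≈ 0#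
      Δf₀≈0 b b≤n = trans (Δ^-cong b (f-const 0# (proj₁ (W b))) (proj₂ (W b)))
        (trans (sym (Δy^-section b f (proj₁ (W b)) (proj₂ (W b)))) (Δf≈0 b b≤n))

  deg≤²-Δxy^-nodes⇒≈0 : ∀ m n {f} → Deg≤² m n f → (W : NodeSet R) →
    (∀ a b → a ℕ.≤ m → b ℕ.≤ n → Δxy^ a b f (W a b) ≈ 0#) → f ≐² (λ _ → 0#)
  deg≤²-Δxy^-nodes⇒≈0 zero    n (fˣ , fʸ) W Δf≈0 =
    x-const⇒≈0 n fʸ (λ x x′ y → fˣ y x x′) (W 0) (λ b b≤n → Δf≈0 0 b z≤n b≤n)
  deg≤²-Δxy^-nodes⇒≈0 (suc m) n {f} (fˣ , fʸ) W Δf≈0 =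
    x-const⇒≈0 n fʸ (λ x x′ y → Δ≈0⇒const (suc m) (fˣ y) (λ x → Δxf≈0 (x , y)) x x′) (W 0)
      (λ b b≤n → Δf≈0 0 b z≤n b≤n)
    where
    Δxf≈0 : Δx R f ≐² (λ _ → 0#)
    Δxf≈0 = deg≤²-Δxy^-nodes⇒≈0 m n (deg≤²-Δx (suc m) n (fˣ , fʸ)) (λ a → W (suc a))
      (λ a b a≤m b≤n → trans (X.iter-cong a (Δy^-Δx b f) (W (suc a) b))
        (trans (X.iter-D a (Δy^ b f) (W (suc a) b)) (Δf≈0 (suc a) b (s≤s a≤m) b≤n)))

  newton-0 : ∀ m n {f} → Deg≤² m n f → (K : ℕ → ℕ → Carrier) →
    (∀ a b → a ℕ.≤ m → b ℕ.≤ n → Δxy^ a b f (0# , 0#) ≈ K a b * natF R (a !) * natF R (b !)) →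
    f ≐² newtonSum m n K
  newton-0 m n {f} f≤ K Δf≈K p = x∙y⁻¹≈ε⇒x≈y _ _
    (deg≤²-Δxy^-nodes⇒≈0 m n (deg≤²-- m n f≤ (deg≤²-newtonSum m n K)) (λ _ _ → 0# , 0#)
      (λ a b a≤m b≤n → trans (Δxy^-- a b f (newtonSum m n K) (0# , 0#))
        (x≈y⇒x∙y⁻¹≈ε (trans (Δf≈K a b a≤m b≤n) (sym (Δxy^-newtonSum-0 m n K a b a≤m b≤n)))))
      p)

  newton : ∀ m n {f} → Deg≤² m n f → (b c : Carrier) (K : ℕ → ℕ → Carrier) →
    (∀ i j → i ℕ.≤ m → j ℕ.≤ n → Δxy^ i j f (b , c) ≈ K i j * natF R (i !) * natF R (j !)) →
    ∀ x y → f (x + b , y + c) ≈ newtonSum m n K (x , y)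
  newton m n f≤ b c K Δf≈K x y = newton-0 m n (deg≤²-shift m n b c f≤) K
    (λ i j i≤m j≤n → trans (Δxy^-shift m n i j b c f≤ (0# , 0#))
      (trans (deg≤²⇒cong _ _ (deg≤²-Δxy^ m n i j f≤) (+-identityˡ b) (+-identityˡ c))
             (Δf≈K i j i≤m j≤n)))
    (x , y)

module GTilde {c ℓ : Level} (R : CommutativeRing c ℓ) (isField : IsField R) (charZero : CharZero R)
  where
  open CommutativeRing R hiding (zero)
  open import Algebra.Properties.Ring ring
  open import Relation.Binary.Reasoning.Setoid setoid
  open NatCast R
  open RingSolver R
  open Bivariate R
  open Interpolation R isField charZero

  target-≡ : ∀ m n → target R m n m n ≈ natF R (m ! ℕ.* n !)
  target-≡ m n rewrite dec-true (m ℕ.≟ m) ≡.refl | dec-true (n ℕ.≟ n) ≡.refl = refl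

  target-≢ˡ : ∀ {m n i} j → i ≢ m → target R m n i j ≈ 0#
  target-≢ˡ {m} {i = i} j i≢m rewrite dec-false (i ℕ.≟ m) i≢m = refl

  target-≢ʳ : ∀ {m n j} i → j ≢ n → target R m n i j ≈ 0#
  target-≢ʳ {m} {n} {j} i j≢n
    rewrite dec-false (j ℕ.≟ n) j≢n | ∧-zeroʳ (does (i ℕ.≟ m)) = refl

  private
    ∸-cancel : ∀ {x k l} → x ℕ.+ k ≡ l → x ≡ l ∸ k
    ∸-cancel {x} {k} e = ≡.trans (≡.sym (ℕP.m+n∸n≡m x k)) (≡.cong (_∸ k) e)

    both≈0 : ∀ {u v x y} → x ≈ 0# → y ≈ 0# → u * x ≈ v * y
    both≈0 x≈0 y≈0 = trans (*-congˡ x≈0) (trans (zeroʳ _) (sym (trans (*-congˡ y≈0) (zeroʳ _))))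

  target-shift : ∀ {m n i j} a b → i ℕ.≤ m → j ℕ.≤ n →
    natF R ((m ∸ i) ! ℕ.* (n ∸ j) !) * target R m n (a ℕ.+ i) (b ℕ.+ j) ≈
    natF R (m ! ℕ.* n !) * target R (m ∸ i) (n ∸ j) a b
  target-shift {m} {n} {i} {j} a b i≤m j≤n with a ℕ.≟ m ∸ i | b ℕ.≟ n ∸ j
  ... | yes ≡.refl | yes ≡.refl rewrite ℕP.m∸n+n≡m i≤m | ℕP.m∸n+n≡m j≤n =
    trans (*-congˡ (target-≡ m n)) (trans (*-comm _ _) (*-congˡ (sym (target-≡ (m ∸ i) (n ∸ j)))))
  ... | no a≢m-i | _ =
    both≈0 (target-≢ˡ (b ℕ.+ j) (λ a+i≡m → a≢m-i (∸-cancel a+i≡m))) (target-≢ˡ b a≢m-i)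
  ... | yes _ | no b≢n-j =
    both≈0 (target-≢ʳ (a ℕ.+ i) (λ b+j≡n → b≢n-j (∸-cancel b+j≡n))) (target-≢ʳ a b≢n-j)

  gTilde-Δxy^ : ∀ {Z m n i j} (g : Poly R m n) (h : Poly R (m ∸ i) (n ∸ j)) →
    IsGTilde R m n Z g → IsGTilde R (m ∸ i) (n ∸ j) (shiftNodes R i j Z) h → i ℕ.≤ m → j ℕ.≤ n →
    ∀ p → natF R ((m ∸ i) ! ℕ.* (n ∸ j) !) * Δxy^ i j (eval R g) p ≈ natF R (m ! ℕ.* n !) * eval R h p
  gTilde-Δxy^ {Z} {m} {n} {i} {j} g h g̃ h̃ i≤m j≤n p = x∙y⁻¹≈ε⇒x≈y _ _
    (deg≤²-Δxy^-nodes⇒≈0 (m ∸ i) (n ∸ j) F≤ (shiftNodes R i j Z) ΔF≈0 p)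
    where
    A B : Carrier
    A = natF R ((m ∸ i) ! ℕ.* (n ∸ j) !)
    B = natF R (m ! ℕ.* n !)
    G : Fun²
    G = Δxy^ i j (eval R g)
    F≤ : Deg≤² (m ∸ i) (n ∸ j) (λ p → A * G p - B * eval R h p)
    F≤ = deg≤²-- _ _ (deg≤²-*ˡ _ _ A (deg≤²-Δxy^ m n i j (deg≤²-eval g)))
                     (deg≤²-*ˡ _ _ B (deg≤²-eval h))
    ΔF≈0 : ∀ a b → a ℕ.≤ m ∸ i → b ℕ.≤ n ∸ j →
           Δxy^ a b (λ p → A * G p - B * eval R h p) (Z (a ℕ.+ i) (b ℕ.+ j)) ≈ 0#
    ΔF≈0 a b a≤ b≤ = trans (Δxy^-- a b _ _ z)
      (x≈y⇒x∙y⁻¹≈ε (trans (Δxy^-*ˡ a b A G z)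
        (trans AΔG≈BΔh (sym (Δxy^-*ˡ a b B (eval R h) z)))))
      where
      z = Z (a ℕ.+ i) (b ℕ.+ j)
      AΔG≈BΔh : A * Δxy^ a b G z ≈ B * Δxy^ a b (eval R h) z
      AΔG≈BΔh = begin
        A * Δxy^ a b G z                         ≈⟨ *-congˡ (Δxy^-Δxy^ a b i j (eval R g) z) ⟩
        A * Δxy^ (a ℕ.+ i) (b ℕ.+ j) (eval R g) z
          ≈⟨ *-congˡ (g̃ _ _ (ℕP.m≤o∸n⇒m+n≤o a i≤m a≤) (ℕP.m≤o∸n⇒m+n≤o b j≤n b≤)) ⟩
        A * target R m n (a ℕ.+ i) (b ℕ.+ j)     ≈⟨ target-shift a b i≤m j≤n ⟩
        B * target R (m ∸ i) (n ∸ j) a b         ≈⟨ *-congˡ (h̃ a b a≤ b≤) ⟨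
        B * Δxy^ a b (eval R h) z                ∎

  natF-C*!*! : ∀ {m i} → i ℕ.≤ m →
               natF R (m C i) * (natF R (i !) * natF R ((m ∸ i) !)) ≈ natF R (m !)
  natF-C*!*! {m} {i} i≤m = begin
    natF R (m C i) * (natF R (i !) * natF R ((m ∸ i) !)) ≈⟨ *-congˡ (natF-* (i !) ((m ∸ i) !)) ⟨
    natF R (m C i) * natF R (i ! ℕ.* (m ∸ i) !)          ≈⟨ natF-* (m C i) _ ⟨
    natF R ((m C i) ℕ.* (i ! ℕ.* (m ∸ i) !))             ≡⟨ ≡.cong (natF R) C*!*!≡! ⟩
    natF R (m !)                                         ∎
    where
    instance _ = ℕP._!*_!≢0 i (m ∸ i)
    C*!*!≡! : (m C i) ℕ.* (i ! ℕ.* (m ∸ i) !) ≡ m !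
    C*!*!≡! = ≡.trans (≡.cong (ℕ._* (i ! ℕ.* (m ∸ i) !)) (nCk≡n!/k![n-k]! i≤m))
                      (m/n*n≡m (k![n∸k]!∣n! i≤m))

  gTilde-Δxy^-binomial : ∀ {Z m n i j} (g : Poly R m n) (h : Poly R (m ∸ i) (n ∸ j)) →
    IsGTilde R m n Z g → IsGTilde R (m ∸ i) (n ∸ j) (shiftNodes R i j Z) h → i ℕ.≤ m → j ℕ.≤ n →
    ∀ p → Δxy^ i j (eval R g) p ≈
          natF R (m C i) * natF R (n C j) * eval R h p * natF R (i !) * natF R (j !)
  gTilde-Δxy^-binomial {_} {m} {n} {i} {j} g h g̃ h̃ i≤m j≤n p =
    *-cancelˡ A≉0 (trans (gTilde-Δxy^ g h g̃ h̃ i≤m j≤n p) (begin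
      natF R (m ! ℕ.* n !) * e                             ≈⟨ *-congʳ (natF-* (m !) (n !)) ⟩
      (natF R (m !) * natF R (n !)) * e
        ≈⟨ *-congʳ (*-cong (natF-C*!*! i≤m) (natF-C*!*! j≤n)) ⟨
      ((cm * (fi * fm)) * (cn * (fj * fn))) * e
        ≈⟨ solve 7 (λ fm fn cm cn e fi fj →
             ((cm :* (fi :* fm)) :* (cn :* (fj :* fn))) :* e
               := (fm :* fn) :* ((((cm :* cn) :* e) :* fi) :* fj))
           refl fm fn cm cn e fi fj ⟩
      (fm * fn) * (cm * cn * e * fi * fj)                  ≈⟨ *-congʳ (natF-* ((m ∸ i) !) ((n ∸ j) !)) ⟨
      natF R ((m ∸ i) ! ℕ.* (n ∸ j) !) * (cm * cn * e * fi * fj) ∎))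
    where
    fi = natF R (i !)
    fj = natF R (j !)
    fm = natF R ((m ∸ i) !)
    fn = natF R ((n ∸ j) !)
    cm = natF R (m C i)
    cn = natF R (n C j)
    e = eval R h p
    A≉0 : ¬ natF R ((m ∸ i) ! ℕ.* (n ∸ j) !) ≈ 0#
    A≉0 A≈0 = ℕ.≢-nonZero⁻¹ _ {{ℕP._!*_!≢0 (m ∸ i) (n ∸ j)}} (charZero _ A≈0)

theorem9 : {c ℓ : Level} (R : CommutativeRing c ℓ) → IsField R → CharZero R →
    let open CommutativeRing R in
    (Z : NodeSet R) (m n : ℕ) (b c' : Carrier) →
    (g : Poly R m n) → IsGTilde R m n Z g →
    (h : (i j : ℕ) → Poly R (m ∸ i) (n ∸ j)) →
    (∀ i j → i ℕ.≤ m → j ℕ.≤ n → IsGTilde R (m ∸ i) (n ∸ j) (shiftNodes R i j Z) (h i j)) →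
    ∀ x y →
      eval R g (x + b , y + c') ≈
        sumTo R m (λ i → sumTo R n (λ j →
          natF R (m C i) * natF R (n C j) * eval R (h i j) (b , c')
            * rising R x i * rising R y j))
theorem9 R isField charZero Z m n b c′ g g̃ h h̃ =
  newton m n (deg≤²-eval g) b c′ K
    (λ i j i≤m j≤n → gTilde-Δxy^-binomial g (h i j) g̃ (h̃ i j i≤m j≤n) i≤m j≤n (b , c′))
  where
  open CommutativeRing R
  open Bivariate R
  open Interpolation R isField charZero
  open GTilde R isField charZero
  K : ℕ → ℕ → Carrier
  K i j = natF R (m C i) * natF R (n C j) * eval R (h i j) (b , c′)
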